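{- Let $p \geq 5$ be prime and $A \subseteq \mathbb{Z}_p^2$ with $|A| = 2p+1$. Let $H$ be a subgroup of $\mathbb{Z}_p^2$ of order $p$, with cosets indexed $H_0 = H, H_1, \dots, H_{p-1}$ so that $H_i + H_j = H_{i+j}$ (indices mod $p$). Put $A_i = A \cap H_i$ and $B_i = \hat{2}A \cap H_i$, where $\hat{2}A = \{a_1+a_2 \mid a_1,a_2 \in A, a_1 \neq a_2\}$. Assume $|A_0| \geq |A_i|$ for all $i$, and that $|A_0| \geq \frac{p+3}{2}$. Let $S = \{i \in \{1,\dots,p-1\} \mid A_i \neq \emptyset\}$ and $T = \{i \in \{1,\dots,p-1\} \mid B_i \neq \emptyset\}$. Let $\ell$ be the number of $i \in \{1,\dots,p-1\}$ with $|A_0| + |A_i| - 1 \geq p$, and let $s$ be the number of $i \in \{1,\dots,p-1\}$ with $A_i \neq \emptyset$ and $|A_0| + |A_i| - 1 < p$. Then $$|\hat{2}A| \geq (\ell+1)p + s|A_0| + \sum_{i \in T \setminus S} |B_i|.$$ -}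

module Defs where

open import Data.Nat using (ℕ; zero; suc; _+_; _*_; _∸_; _≤_; _<_; _≤ᵇ_; NonZero; _≤?_; _<ᵇ_)
open import Data.Nat.DivMod using (_mod_)
open import Data.Fin using (Fin; toℕ)
open import Data.Fin.Properties using () renaming (_≟_ to _≟F_)
open import Data.Bool using (Bool; true; false; _∧_; not; if_then_else_)
open import Data.Bool.Properties using () renaming (_≟_ to _≟B_)
open import Data.Product using (_×_; _,_)
open import Data.List using (List; length; filter; map; concatMap; allFin)
open import Data.Bool.ListAction using (any)
open import Data.Nat.ListAction using (sum)
open import Relation.Nullary.Decidable using (Dec; ⌊_⌋)
open import Relation.Binary.PropositionalEquality using (_≡_)
open import Data.Product.Properties using (≡-dec)

module _ {p : ℕ} .{{_ : NonZero p}} where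

  _+ₚ_ : Fin p → Fin p → Fin p
  a +ₚ b = (toℕ a + toℕ b) mod p

  -ₚ_ : Fin p → Fin p
  -ₚ a = (p ∸ toℕ a) mod p

  0ₚ : Fin p
  0ₚ = 0 mod p

G : ℕ → Set
G p = Fin p × Fin p

Subset : ℕ → Set
Subset p = G p → Bool

module _ {p : ℕ} .{{_ : NonZero p}} where

  _⊕_ : G p → G p → G p
  (a , b) ⊕ (c , d) = (a +ₚ c) , (b +ₚ d)

  ⊖_ : G p → G p
  ⊖ (a , b) = (-ₚ a) , (-ₚ b)

  𝟘 : G p
  𝟘 = 0ₚ , 0ₚ

_≟G_ : {p : ℕ} → (x y : G p) → Dec (x ≡ y)
_≟G_ = ≡-dec _≟F_ _≟F_

allG : (p : ℕ) → List (G p)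
allG p = concatMap (λ x → map (x ,_) (allFin p)) (allFin p)

card : {p : ℕ} → Subset p → ℕ
card {p} X = length (filter (λ x → X x ≟B true) (allG p))

nonempty : {p : ℕ} → Subset p → Bool
nonempty {p} X = any X (allG p)

_∩_ : {p : ℕ} → Subset p → Subset p → Subset p
(X ∩ Y) x = X x ∧ Y x

-- restricted sumset  2^A = { a₁ + a₂ | a₁, a₂ ∈ A, a₁ ≠ a₂ }
-- x ∈ 2^A  iff  there is a₁ ∈ A with a₂ := x − a₁ ∈ A and a₁ ≠ a₂
-- (a₂ is uniquely determined by a₁ and x).

module _ {p : ℕ} .{{_ : NonZero p}} where

  restrictedSumset : Subset p → Subset p
  restrictedSumset A x =
    any (λ a₁ → A a₁ ∧ A (x ⊕ (⊖ a₁)) ∧ not ⌊ a₁ ≟G (x ⊕ (⊖ a₁)) ⌋) (allG p)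

  -- coset H_i, described by a coset-index map idx : ℤ_p² → ℤ_p
  coset : (G p → Fin p) → Fin p → Subset p
  coset idx i x = ⌊ idx x ≟F i ⌋

nonzeroIdx : (p : ℕ) → List (Fin p)
nonzeroIdx p = filter (λ i → 1 ≤? toℕ i) (allFin p)

sumNZ : (p : ℕ) → (Fin p → ℕ) → ℕ
sumNZ p f = sum (map f (nonzeroIdx p))

countNZ : (p : ℕ) → (Fin p → Bool) → ℕ
countNZ p P = length (filter (λ i → P i ≟B true) (nonzeroIdx p))

module Submission where

-- Cut A and its restricted sumset along the cosets Hᵢ = idx⁻¹(i) of H. In H₀,
-- since 2|A₀| ≥ p + 3, for every x ∈ H₀ the sets A₀ and x − A₀ (both inside H₀,
-- of size |A₀|) share at least two points, and as p is odd at most one of them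
-- solves 2a = x; so x ∈ 2^A and B₀ = H₀. For i ≠ 0 and c ∈ Aᵢ, the translate
-- A₀ + c lies in Bᵢ (the two summands lie in different cosets, hence are
-- distinct), so |Bᵢ| ≥ |A₀|; if moreover |A₀| + |Aᵢ| > p, then for every z ∈ Hᵢ
-- the sets A₀ and z − Aᵢ inside H₀ must meet, so Bᵢ = Hᵢ. Summing |Bᵢ| over all
-- cosets gives the bound.

open import Defs
open import Algebra.Bundles using (AbelianGroup)
open import Algebra.Structures using (IsAbelianGroup)
import Algebra.Properties.AbelianGroup as AbelianGroupProperties
import Algebra.Properties.CommutativeSemigroup as CommutativeSemigroupProperties
open import Data.Bool using (Bool; true; false; _∧_; not; T; if_then_else_)
open import Data.Bool.Properties using (T-≡; T-∧; ⇔→≡) renaming (_≟_ to _≟B_)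
open import Data.Empty using (⊥-elim)
open import Data.Fin using (Fin; zero; suc; toℕ)
open import Data.Fin.Permutation using (Permutation; permutation; _⟨$⟩ʳ_)
open import Data.Fin.Properties using (_≟_; toℕ-fromℕ<; toℕ-injective; toℕ<n)
open import Data.List using (List; []; _∷_; length; filter; map; tabulate; allFin; concatMap; cartesianProduct; _++_)
open import Data.List.Properties using (map-++; map-∘; filter-all)
open import Data.List.Membership.Propositional using (_∈_; lose)
open import Data.List.Membership.Propositional.Properties using (∈-allFin; ∈-cartesianProduct⁺; ∈-filter⁻)
open import Data.List.Relation.Unary.All using (_∷_)
open import Data.List.Relation.Unary.All.Properties using (tabulate⁺)
open import Data.List.Relation.Unary.AllPairs using ([]; _∷_)
open import Data.List.Relation.Unary.Any using (here; there; satisfied)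
open import Data.List.Relation.Unary.Any.Properties using (any⁺; any⁻)
open import Data.List.Relation.Unary.Unique.Propositional using (Unique)
open import Data.List.Relation.Unary.Unique.Propositional.Properties using (allFin⁺; cartesianProduct⁺; filter⁺)
open import Data.Nat using (ℕ; zero; suc; _+_; _*_; _∸_; _≤_; _<_; _≤ᵇ_; _<ᵇ_; NonZero; z≤n; s≤s; >-nonZero⁻¹)
open import Data.Nat.DivMod using (_mod_; _%_; %-distribˡ-+; m%n%n≡m%n; m<n⇒m%n≡m; n%n≡0)
open import Data.Nat.Divisibility using (_∣_; m%n≡0⇒n∣m; n∣m⇒m%n≡0; >⇒∤)
import Data.Nat.ListAction as List
open import Data.Nat.ListAction.Properties using (sum-++)
open import Data.Nat.Primality using (Prime; euclidsLemma)
open import Data.Nat.Properties hiding (_≟_)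
open import Data.Nat.Solver using (module +-*-Solver)
open import Algebra.Properties.Semiring.Sum +-*-semiring
  using (sum; sum-syntax; ∑-comm; ∑-distrib-+; *-distribˡ-sum; *-distribʳ-sum; sum-cong-≗; ∑-permute; sum-replicate-zero)
open import Data.Product using (∃-syntax; _×_; _,_; proj₁; proj₂; map₂)
open import Data.Sum using ([_,_]′)
open import Function using (_∘_; Equivalence; mk⇔)
open import Relation.Binary.PropositionalEquality
open import Relation.Nullary using (contradiction)
open import Relation.Nullary.Decidable using (⌊_⌋; ⌊⌋-map′; toWitness; fromWitness; fromWitnessFalse; toWitnessFalse)

𝟙 : Bool → ℕ
𝟙 false = 0
𝟙 true  = 1

𝟙-∧ : ∀ x y → 𝟙 (x ∧ y) ≡ 𝟙 x * 𝟙 y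
𝟙-∧ false y     = refl
𝟙-∧ true  false = refl
𝟙-∧ true  true  = refl

𝟙-mono : ∀ {x y} → (T x → T y) → 𝟙 x ≤ 𝟙 y
𝟙-mono {false} {y}     _   = z≤n
𝟙-mono {true}  {false} x⇒y = ⊥-elim (x⇒y _)
𝟙-mono {true}  {true}  _   = ≤-refl

𝟙-pigeonhole : ∀ x y z d → (T x → T z) → (T y → T z) →
               𝟙 x + 𝟙 y ≤ 𝟙 (x ∧ y ∧ not d) + (𝟙 z + 𝟙 d)
𝟙-pigeonhole false false z     d _   _   = z≤n
𝟙-pigeonhole true  y     false d x⇒z _   = ⊥-elim (x⇒z _)
𝟙-pigeonhole x     true  false d _   y⇒z = ⊥-elim (y⇒z _)
𝟙-pigeonhole true  true  true  true  _ _ = ≤-refl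
𝟙-pigeonhole true  true  true  false _ _ = ≤-refl
𝟙-pigeonhole true  false true  d     _ _ = s≤s z≤n
𝟙-pigeonhole false true  true  d     _ _ = s≤s z≤n

𝟙*≤ : ∀ x n → 𝟙 x * n ≤ n
𝟙*≤ false n = z≤n
𝟙*≤ true  n = ≤-reflexive (+-identityʳ n)

if-then-else-0-≤ : ∀ x n → (if x then n else 0) ≤ n
if-then-else-0-≤ false n = z≤n
if-then-else-0-≤ true  n = ≤-refl

sum-mono : ∀ {n} {f g : Fin n → ℕ} → (∀ i → f i ≤ g i) → sum f ≤ sum g
sum-mono {zero}  f≤g = z≤n
sum-mono {suc n} f≤g = +-mono-≤ (f≤g zero) (sum-mono (f≤g ∘ suc))

∑-δ : ∀ {n} (j : Fin n) → ∑[ i < n ] 𝟙 ⌊ j ≟ i ⌋ ≡ 1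
∑-δ {suc n} zero    = cong suc (sum-replicate-zero n)
∑-δ {suc n} (suc j) = trans (sum-cong-≗ (λ i → cong 𝟙 (⌊⌋-map′ _ _ (j ≟ i)))) (∑-δ j)

sum-map-tabulate : ∀ {A : Set} {n} (h : A → ℕ) (f : Fin n → A) →
                   List.sum (map h (tabulate f)) ≡ ∑[ i < n ] h (f i)
sum-map-tabulate {n = zero}  h f = refl
sum-map-tabulate {n = suc n} h f = cong (h (f zero) +_) (sum-map-tabulate h (f ∘ suc))

sum-map-concatMap : ∀ {A B : Set} (h : B → ℕ) (f : A → List B) xs →
                    List.sum (map h (concatMap f xs)) ≡ List.sum (map (List.sum ∘ map h ∘ f) xs)
sum-map-concatMap h f []       = refl
sum-map-concatMap h f (x ∷ xs) = begin
  List.sum (map h (f x ++ concatMap f xs))                ≡⟨ cong List.sum (map-++ h (f x) _) ⟩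
  List.sum (map h (f x) ++ map h (concatMap f xs))        ≡⟨ sum-++ (map h (f x)) _ ⟩
  List.sum (map h (f x)) + List.sum (map h (concatMap f xs)) ≡⟨ cong (List.sum (map h (f x)) +_) (sum-map-concatMap h f xs) ⟩
  List.sum (map h (f x)) + List.sum (map (List.sum ∘ map h ∘ f) xs) ∎
  where open ≡-Reasoning

∑-𝟙-∧-δ : ∀ {n} b (j : Fin n) → ∑[ i < n ] 𝟙 (b ∧ ⌊ j ≟ i ⌋) ≡ 𝟙 b
∑-𝟙-∧-δ {n} b j = begin
  ∑[ i < n ] 𝟙 (b ∧ ⌊ j ≟ i ⌋)      ≡⟨ sum-cong-≗ (λ i → 𝟙-∧ b ⌊ j ≟ i ⌋) ⟩
  ∑[ i < n ] (𝟙 b * 𝟙 ⌊ j ≟ i ⌋)    ≡⟨ *-distribˡ-sum (𝟙 b) (λ i → 𝟙 ⌊ j ≟ i ⌋) ⟨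
  𝟙 b * ∑[ i < n ] 𝟙 ⌊ j ≟ i ⌋      ≡⟨ cong (𝟙 b *_) (∑-δ j) ⟩
  𝟙 b * 1                           ≡⟨ *-identityʳ (𝟙 b) ⟩
  𝟙 b                               ∎
  where open ≡-Reasoning

length-filter : ∀ {A : Set} (P : A → Bool) xs →
                length (filter (λ x → P x ≟B true) xs) ≡ List.sum (map (𝟙 ∘ P) xs)
length-filter P []       = refl
length-filter P (x ∷ xs) with P x
... | true  = cong suc (length-filter P xs)
... | false = length-filter P xs

length≤1 : ∀ {A : Set} {xs : List A} → Unique xs → (∀ {x y} → x ∈ xs → y ∈ xs → x ≡ y) → length xs ≤ 1
length≤1 []                 _  = z≤n
length≤1 (_ ∷ [])           _  = s≤s z≤n
length≤1 ((x≢y ∷ _) ∷ _ ∷ _) eq = contradiction (eq (here refl) (there (here refl))) x≢y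

module _ {p : ℕ} where

  ∑G : (G p → ℕ) → ℕ
  ∑G f = ∑[ a < p ] ∑[ b < p ] f (a , b)

  ∑G-cong : {f g : G p → ℕ} → (∀ x → f x ≡ g x) → ∑G f ≡ ∑G g
  ∑G-cong f≡g = sum-cong-≗ (λ a → sum-cong-≗ (λ b → f≡g (a , b)))

  ∑G-mono : {f g : G p → ℕ} → (∀ x → f x ≤ g x) → ∑G f ≤ ∑G g
  ∑G-mono f≤g = sum-mono (λ a → sum-mono (λ b → f≤g (a , b)))

  ∑G-distrib-+ : (f g : G p → ℕ) → ∑G (λ x → f x + g x) ≡ ∑G f + ∑G g
  ∑G-distrib-+ f g = trans (sum-cong-≗ (λ a → ∑-distrib-+ (λ b → f (a , b)) (λ b → g (a , b))))
                          (∑-distrib-+ (λ a → ∑[ b < p ] f (a , b)) (λ a → ∑[ b < p ] g (a , b)))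

  ∑-∑G-comm : ∀ {n} (h : Fin n → G p → ℕ) → ∑[ i < n ] ∑G (h i) ≡ ∑G (λ x → ∑[ i < n ] h i x)
  ∑-∑G-comm h = trans (∑-comm (λ i a → ∑[ b < p ] h i (a , b))) (sum-cong-≗ (λ a → ∑-comm (λ i b → h i (a , b))))

  ∑G-permute : (f : G p → ℕ) (π₁ π₂ : Permutation p p) →
               ∑G (λ x → f (π₁ ⟨$⟩ʳ proj₁ x , π₂ ⟨$⟩ʳ proj₂ x)) ≡ ∑G f
  ∑G-permute f π₁ π₂ = begin
    ∑[ a < p ] ∑[ b < p ] f (π₁ ⟨$⟩ʳ a , π₂ ⟨$⟩ʳ b) ≡⟨ sum-cong-≗ (λ a → ∑-permute (λ b → f (π₁ ⟨$⟩ʳ a , b)) π₂) ⟨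
    ∑[ a < p ] ∑[ b < p ] f (π₁ ⟨$⟩ʳ a , b)         ≡⟨ ∑-permute (λ a → ∑[ b < p ] f (a , b)) π₁ ⟨
    ∑[ a < p ] ∑[ b < p ] f (a , b)                 ∎
    where open ≡-Reasoning

  sum-map-allG : (f : G p → ℕ) → List.sum (map f (allG p)) ≡ ∑G f
  sum-map-allG f = begin
    List.sum (map f (allG p))
      ≡⟨ sum-map-concatMap f (λ a → map (a ,_) (allFin p)) (allFin p) ⟩
    List.sum (map (λ a → List.sum (map f (map (a ,_) (allFin p)))) (allFin p))
      ≡⟨ sum-map-tabulate (λ a → List.sum (map f (map (a ,_) (allFin p)))) (λ a → a) ⟩
    ∑[ a < p ] List.sum (map f (map (a ,_) (allFin p)))
      ≡⟨ sum-cong-≗ (λ a → trans (cong List.sum (sym (map-∘ (allFin p)))) (sum-map-tabulate (f ∘ (a ,_)) (λ b → b))) ⟩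
    ∑G f ∎
    where open ≡-Reasoning

  _⊆_ : Subset p → Subset p → Set
  X ⊆ Y = ∀ {x} → T (X x) → T (Y x)

  allG≡cartesianProduct : allG p ≡ cartesianProduct (allFin p) (allFin p)
  allG≡cartesianProduct = go (allFin p)
    where
    go : ∀ xs → concatMap (λ a → map (a ,_) (allFin p)) xs ≡ cartesianProduct xs (allFin p)
    go []       = refl
    go (a ∷ xs) = cong (map (a ,_) (allFin p) ++_) (go xs)

  ∈-allG : (x : G p) → x ∈ allG p
  ∈-allG (a , b) = subst ((a , b) ∈_) (sym allG≡cartesianProduct) (∈-cartesianProduct⁺ (∈-allFin a) (∈-allFin b))

  allG-unique : Unique (allG p)
  allG-unique = subst Unique (sym allG≡cartesianProduct) (cartesianProduct⁺ (allFin⁺ p) (allFin⁺ p))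

  nonempty-intro : (X : Subset p) {x : G p} → T (X x) → T (nonempty X)
  nonempty-intro X {x} Xx = any⁺ X (lose (∈-allG x) Xx)

  nonempty-witness : (X : Subset p) → T (nonempty X) → ∃[ x ] T (X x)
  nonempty-witness X = satisfied ∘ any⁻ X (allG p)

  card≡∑G : (X : Subset p) → card X ≡ ∑G (𝟙 ∘ X)
  card≡∑G X = trans (length-filter X (allG p)) (sum-map-allG (𝟙 ∘ X))

  card-cong : {X Y : Subset p} → (∀ x → X x ≡ Y x) → card X ≡ card Y
  card-cong {X} {Y} X≗Y = trans (card≡∑G X) (trans (∑G-cong (cong 𝟙 ∘ X≗Y)) (sym (card≡∑G Y)))

  card-∅ : card {p} (λ _ → false) ≡ 0
  card-∅ = begin
    card {p} (λ _ → false)   ≡⟨ card≡∑G (λ _ → false) ⟩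
    ∑[ a < p ] ∑[ b < p ] 0  ≡⟨ sum-cong-≗ {n = p} {x = λ _ → ∑[ b < p ] 0} {y = λ _ → 0} (λ _ → sum-replicate-zero p) ⟩
    ∑[ a < p ] 0             ≡⟨ sum-replicate-zero p ⟩
    0                        ∎
    where open ≡-Reasoning

  card-mono : {X Y : Subset p} → X ⊆ Y → card X ≤ card Y
  card-mono {X} {Y} X⊆Y = subst₂ _≤_ (sym (card≡∑G X)) (sym (card≡∑G Y)) (∑G-mono (λ x → 𝟙-mono (X⊆Y {x})))

  card-permute : (X : Subset p) (π₁ π₂ : Permutation p p) →
                 card (λ x → X (π₁ ⟨$⟩ʳ proj₁ x , π₂ ⟨$⟩ʳ proj₂ x)) ≡ card X
  card-permute X π₁ π₂ = trans (card≡∑G _) (trans (∑G-permute (𝟙 ∘ X) π₁ π₂) (sym (card≡∑G X)))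

  ∈-filter-allG⁻ : (X : Subset p) {x : G p} → x ∈ filter (λ y → X y ≟B true) (allG p) → T (X x)
  ∈-filter-allG⁻ X x∈ = Equivalence.from T-≡ (proj₂ (∈-filter⁻ (λ y → X y ≟B true) {xs = allG p} x∈))

  card-witness : (X : Subset p) → 1 ≤ card X → ∃[ x ] T (X x)
  card-witness X 1≤card with filter (λ x → X x ≟B true) (allG p) in eq
  ... | x ∷ _ = x , ∈-filter-allG⁻ X (subst (x ∈_) (sym eq) (here refl))

  card-subsingleton : (X : Subset p) → (∀ {x y} → T (X x) → T (X y) → x ≡ y) → card X ≤ 1
  card-subsingleton X X≤1 = length≤1 (filter⁺ (λ x → X x ≟B true) {allG p} allG-unique)
                                      (λ x∈ y∈ → X≤1 (∈-filter-allG⁻ X x∈) (∈-filter-allG⁻ X y∈))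

  inclusion-exclusion-≤ : {X Y Z : Subset p} (D : Subset p) → X ⊆ Z → Y ⊆ Z →
                          card X + card Y ≤ card (λ x → X x ∧ Y x ∧ not (D x)) + (card Z + card D)
  inclusion-exclusion-≤ {X} {Y} {Z} D X⊆Z Y⊆Z = begin
    card X + card Y                             ≡⟨ cong₂ _+_ (card≡∑G X) (card≡∑G Y) ⟩
    ∑G (𝟙 ∘ X) + ∑G (𝟙 ∘ Y)                     ≡⟨ ∑G-distrib-+ (𝟙 ∘ X) (𝟙 ∘ Y) ⟨
    ∑G (λ x → 𝟙 (X x) + 𝟙 (Y x))                ≤⟨ ∑G-mono (λ x → 𝟙-pigeonhole (X x) (Y x) (Z x) (D x) X⊆Z Y⊆Z) ⟩
    ∑G (λ x → 𝟙 (W x) + (𝟙 (Z x) + 𝟙 (D x)))    ≡⟨ ∑G-distrib-+ (𝟙 ∘ W) _ ⟩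
    ∑G (𝟙 ∘ W) + ∑G (λ x → 𝟙 (Z x) + 𝟙 (D x))   ≡⟨ cong (∑G (𝟙 ∘ W) +_) (∑G-distrib-+ (𝟙 ∘ Z) (𝟙 ∘ D)) ⟩
    ∑G (𝟙 ∘ W) + (∑G (𝟙 ∘ Z) + ∑G (𝟙 ∘ D))      ≡⟨ cong₂ (λ w z → w + (z + ∑G (𝟙 ∘ D))) (card≡∑G W) (card≡∑G Z) ⟨
    card W + (card Z + ∑G (𝟙 ∘ D))              ≡⟨ cong (λ d → card W + (card Z + d)) (card≡∑G D) ⟨
    card W + (card Z + card D)                  ∎
    where
    open ≤-Reasoning
    W : Subset p
    W x = X x ∧ Y x ∧ not (D x)

  pigeonhole : {X Y Z : Subset p} (D : Subset p) → X ⊆ Z → Y ⊆ Z →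
               card Z + card D < card X + card Y → ∃[ x ] T (X x) × T (Y x) × T (not (D x))
  pigeonhole {X} {Y} {Z} D X⊆Z Y⊆Z Z+D<X+Y
    with x , XYDx ← card-witness _ (+-cancelʳ-< (card Z + card D) 0 _
                      (<-≤-trans Z+D<X+Y (inclusion-exclusion-≤ D X⊆Z Y⊆Z)))
    with Xx , YDx ← Equivalence.to T-∧ XYDx
    = x , Xx , Equivalence.to T-∧ YDx

  card-partition : ∀ {n} (X : Subset p) (f : G p → Fin n) → card X ≡ ∑[ i < n ] card (X ∩ λ x → ⌊ f x ≟ i ⌋)
  card-partition {n} X f = sym (begin
    ∑[ i < n ] card (X ∩ λ x → ⌊ f x ≟ i ⌋)          ≡⟨ sum-cong-≗ (λ i → card≡∑G (X ∩ λ x → ⌊ f x ≟ i ⌋)) ⟩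
    ∑[ i < n ] ∑G (λ x → 𝟙 (X x ∧ ⌊ f x ≟ i ⌋))      ≡⟨ ∑-∑G-comm (λ i x → 𝟙 (X x ∧ ⌊ f x ≟ i ⌋)) ⟩
    ∑G (λ x → ∑[ i < n ] 𝟙 (X x ∧ ⌊ f x ≟ i ⌋))      ≡⟨ ∑G-cong (λ x → ∑-𝟙-∧-δ (X x) (f x)) ⟩
    ∑G (𝟙 ∘ X)                                      ≡⟨ card≡∑G X ⟨
    card X                                          ∎)
    where open ≡-Reasoning

≤∸1⇒< : ∀ {m} n .{{_ : NonZero m}} → m ≤ n ∸ 1 → m < n
≤∸1⇒< {suc m} zero    ()
≤∸1⇒< (suc n) m≤n = s≤s m≤n

module ℤₚ {p : ℕ} .{{_ : NonZero p}} where

  toℕ-mod : ∀ m → toℕ (m mod p) ≡ m % p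
  toℕ-mod m = toℕ-fromℕ< _

  toℕ-0ₚ : toℕ (0ₚ {p}) ≡ 0
  toℕ-0ₚ = trans (toℕ-mod 0) (m<n⇒m%n≡m (>-nonZero⁻¹ p))

  %-absorbˡ : ∀ m n → (m % p + n) % p ≡ (m + n) % p
  %-absorbˡ m n = begin
    (m % p + n) % p         ≡⟨ %-distribˡ-+ (m % p) n p ⟩
    (m % p % p + n % p) % p ≡⟨ cong (λ t → (t + n % p) % p) (m%n%n≡m%n m p) ⟩
    (m % p + n % p) % p     ≡⟨ %-distribˡ-+ m n p ⟨
    (m + n) % p             ∎
    where open ≡-Reasoning

  %-absorbʳ : ∀ m n → (m + n % p) % p ≡ (m + n) % p
  %-absorbʳ m n = begin
    (m + n % p) % p ≡⟨ cong (_% p) (+-comm m (n % p)) ⟩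
    (n % p + m) % p ≡⟨ %-absorbˡ n m ⟩
    (n + m) % p     ≡⟨ cong (_% p) (+-comm n m) ⟩
    (m + n) % p     ∎
    where open ≡-Reasoning

  +ₚ-assoc : ∀ a b c → (a +ₚ b) +ₚ c ≡ a +ₚ (b +ₚ c)
  +ₚ-assoc a b c = toℕ-injective (begin
    toℕ ((a +ₚ b) +ₚ c)                  ≡⟨ toℕ-mod _ ⟩
    (toℕ (a +ₚ b) + toℕ c) % p           ≡⟨ cong (λ t → (t + toℕ c) % p) (toℕ-mod _) ⟩
    ((toℕ a + toℕ b) % p + toℕ c) % p    ≡⟨ %-absorbˡ (toℕ a + toℕ b) (toℕ c) ⟩
    (toℕ a + toℕ b + toℕ c) % p          ≡⟨ cong (_% p) (+-assoc (toℕ a) (toℕ b) (toℕ c)) ⟩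
    (toℕ a + (toℕ b + toℕ c)) % p        ≡⟨ %-absorbʳ (toℕ a) (toℕ b + toℕ c) ⟨
    (toℕ a + (toℕ b + toℕ c) % p) % p    ≡⟨ cong (λ t → (toℕ a + t) % p) (toℕ-mod _) ⟨
    (toℕ a + toℕ (b +ₚ c)) % p           ≡⟨ toℕ-mod _ ⟨
    toℕ (a +ₚ (b +ₚ c))                  ∎)
    where open ≡-Reasoning

  +ₚ-comm : ∀ a b → a +ₚ b ≡ b +ₚ a
  +ₚ-comm a b = cong (_mod p) (+-comm (toℕ a) (toℕ b))

  +ₚ-identityʳ : ∀ a → a +ₚ 0ₚ ≡ a
  +ₚ-identityʳ a = toℕ-injective (begin
    toℕ (a +ₚ 0ₚ)              ≡⟨ toℕ-mod _ ⟩
    (toℕ a + toℕ (0ₚ {p})) % p ≡⟨ cong (λ t → (toℕ a + t) % p) toℕ-0ₚ ⟩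
    (toℕ a + 0) % p            ≡⟨ cong (_% p) (+-identityʳ (toℕ a)) ⟩
    toℕ a % p                  ≡⟨ m<n⇒m%n≡m (toℕ<n a) ⟩
    toℕ a                      ∎)
    where open ≡-Reasoning

  +ₚ-inverseʳ : ∀ a → a +ₚ (-ₚ a) ≡ 0ₚ
  +ₚ-inverseʳ a = toℕ-injective (begin
    toℕ (a +ₚ (-ₚ a))            ≡⟨ toℕ-mod _ ⟩
    (toℕ a + toℕ (-ₚ a)) % p     ≡⟨ cong (λ t → (toℕ a + t) % p) (toℕ-mod _) ⟩
    (toℕ a + (p ∸ toℕ a) % p) % p ≡⟨ %-absorbʳ (toℕ a) (p ∸ toℕ a) ⟩
    (toℕ a + (p ∸ toℕ a)) % p    ≡⟨ cong (_% p) (m+[n∸m]≡n (<⇒≤ (toℕ<n a))) ⟩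
    p % p                        ≡⟨ n%n≡0 p ⟩
    0                            ≡⟨ toℕ-0ₚ ⟨
    toℕ (0ₚ {p})                 ∎)
    where open ≡-Reasoning

  isAbelianGroup : IsAbelianGroup _≡_ _+ₚ_ 0ₚ -ₚ_
  isAbelianGroup = record
    { isGroup = record
      { isMonoid = record
        { isSemigroup = record
          { isMagma = record { isEquivalence = isEquivalence ; ∙-cong = cong₂ _+ₚ_ }
          ; assoc = +ₚ-assoc
          }
        ; identity = (λ a → trans (+ₚ-comm 0ₚ a) (+ₚ-identityʳ a)) , +ₚ-identityʳ
        }
      ; inverse = (λ a → trans (+ₚ-comm (-ₚ a) a) (+ₚ-inverseʳ a)) , +ₚ-inverseʳ
      ; ⁻¹-cong = cong -ₚ_
      }
    ; comm = +ₚ-comm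
    }

  abelianGroup : AbelianGroup _ _
  abelianGroup = record { isAbelianGroup = isAbelianGroup }

  open AbelianGroupProperties abelianGroup public
    using (//-rightDividesˡ; //-rightDividesʳ; xyx⁻¹≈y; identityʳ-unique; x∙y⁻¹≈ε⇒x≈y; ⁻¹-∙-comm)
  open CommutativeSemigroupProperties (AbelianGroup.commutativeSemigroup abelianGroup)
    using (interchange)

  x−[x−a]≡a : ∀ x a → x +ₚ (-ₚ (x +ₚ (-ₚ a))) ≡ a
  x−[x−a]≡a x a = begin
    x +ₚ (-ₚ (x +ₚ (-ₚ a)))                    ≡⟨ cong (_+ₚ (-ₚ (x +ₚ (-ₚ a)))) (//-rightDividesˡ a x) ⟨
    ((x +ₚ (-ₚ a)) +ₚ a) +ₚ (-ₚ (x +ₚ (-ₚ a)))  ≡⟨ xyx⁻¹≈y (x +ₚ (-ₚ a)) a ⟩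
    a                                          ∎
    where open ≡-Reasoning

  p∣toℕ⇒≡0ₚ : ∀ w → p ∣ toℕ w → w ≡ 0ₚ
  p∣toℕ⇒≡0ₚ w p∣w = toℕ-injective (begin
    toℕ w         ≡⟨ m<n⇒m%n≡m (toℕ<n w) ⟨
    toℕ w % p     ≡⟨ n∣m⇒m%n≡0 _ p p∣w ⟩
    0             ≡⟨ toℕ-0ₚ ⟨
    toℕ (0ₚ {p})  ∎)
    where open ≡-Reasoning

  double≡0ₚ⇒≡0ₚ : Prime p → 2 < p → ∀ w → w +ₚ w ≡ 0ₚ → w ≡ 0ₚ
  double≡0ₚ⇒≡0ₚ p-prime 2<p w 2w≡0 =
    [ (λ p∣2 → contradiction p∣2 (>⇒∤ 2<p)) , p∣toℕ⇒≡0ₚ w ]′ (euclidsLemma 2 (toℕ w) p-prime p∣2w)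
    where
    open ≡-Reasoning
    p∣2w : p ∣ 2 * toℕ w
    p∣2w = m%n≡0⇒n∣m _ p (begin
      (2 * toℕ w) % p      ≡⟨ cong (λ t → (toℕ w + t) % p) (+-identityʳ (toℕ w)) ⟩
      (toℕ w + toℕ w) % p  ≡⟨ toℕ-mod _ ⟨
      toℕ (w +ₚ w)         ≡⟨ cong toℕ 2w≡0 ⟩
      toℕ (0ₚ {p})         ≡⟨ toℕ-0ₚ ⟩
      0                    ∎)

  double-injective : Prime p → 2 < p → ∀ u v → u +ₚ u ≡ v +ₚ v → u ≡ v
  double-injective p-prime 2<p u v 2u≡2v = x∙y⁻¹≈ε⇒x≈y u v (double≡0ₚ⇒≡0ₚ p-prime 2<p (u +ₚ (-ₚ v)) (begin
    (u +ₚ (-ₚ v)) +ₚ (u +ₚ (-ₚ v))   ≡⟨ interchange u (-ₚ v) u (-ₚ v) ⟩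
    (u +ₚ u) +ₚ ((-ₚ v) +ₚ (-ₚ v))   ≡⟨ cong₂ _+ₚ_ 2u≡2v (⁻¹-∙-comm v v) ⟩
    (v +ₚ v) +ₚ (-ₚ (v +ₚ v))        ≡⟨ +ₚ-inverseʳ (v +ₚ v) ⟩
    0ₚ                               ∎))
    where open ≡-Reasoning

module _ {p : ℕ} .{{_ : NonZero p}} where
  open ℤₚ

  infixl 6 _−_
  _−_ : G p → G p → G p
  x − a = x ⊕ (⊖ a)

  −-⊕-cancel : ∀ z a → (z − a) ⊕ a ≡ z
  −-⊕-cancel (z₁ , z₂) (a₁ , a₂) = cong₂ _,_ (//-rightDividesˡ a₁ z₁) (//-rightDividesˡ a₂ z₂)

  ⊕-−-cancelˡ : ∀ y c → (y ⊕ c) − y ≡ c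
  ⊕-−-cancelˡ (y₁ , y₂) (c₁ , c₂) = cong₂ _,_ (xyx⁻¹≈y y₁ c₁) (xyx⁻¹≈y y₂ c₂)

  ⊕-double-injective : Prime p → 2 < p → ∀ a b → a ⊕ a ≡ b ⊕ b → a ≡ b
  ⊕-double-injective pr 2<p (a₁ , a₂) (b₁ , b₂) 2a≡2b =
    cong₂ _,_ (double-injective pr 2<p a₁ b₁ (cong proj₁ 2a≡2b))
              (double-injective pr 2<p a₂ b₂ (cong proj₂ 2a≡2b))

  translation : Fin p → Permutation p p
  translation c = permutation (_+ₚ c) (_+ₚ (-ₚ c)) (//-rightDividesˡ c) (//-rightDividesʳ c)

  reflection : Fin p → Permutation p p
  reflection x = permutation (λ a → x +ₚ (-ₚ a)) (λ a → x +ₚ (-ₚ a)) (x−[x−a]≡a x) (x−[x−a]≡a x)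

  card-translate : (X : Subset p) (c : G p) → card (λ x → X (x ⊕ c)) ≡ card X
  card-translate X (c₁ , c₂) = card-permute X (translation c₁) (translation c₂)

  card-reflect : (X : Subset p) (x : G p) → card (λ a → X (x − a)) ≡ card X
  card-reflect X (x₁ , x₂) = card-permute X (reflection x₁) (reflection x₂)

  card-≤-translate : {X Y : Subset p} (c : G p) → Y ⊆ (λ y → X (y ⊕ c)) → card Y ≤ card X
  card-≤-translate {X} {Y} c Y⊆X-c = begin
    card Y                     ≤⟨ card-mono {X = Y} {Y = λ y → X (y ⊕ c)} Y⊆X-c ⟩
    card (λ y → X (y ⊕ c))     ≡⟨ card-translate X c ⟩
    card X                     ∎
    where open ≤-Reasoning

  restrictedSumset-intro : (A : Subset p) {x a : G p} → T (A a) → T (A (x − a)) → a ≢ x − a →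
                           T (restrictedSumset A x)
  restrictedSumset-intro A {x} {a} Aa Ax−a a≢x−a =
    nonempty-intro (λ a₁ → A a₁ ∧ A (x − a₁) ∧ not ⌊ a₁ ≟G (x − a₁) ⌋)
      (Equivalence.from T-∧ (Aa , Equivalence.from T-∧ (Ax−a , fromWitnessFalse a≢x−a)))

nonzeroIdx-suc : ∀ q → nonzeroIdx (suc q) ≡ tabulate suc
nonzeroIdx-suc q = filter-all (λ i → 1 ≤? toℕ i) (tabulate⁺ (λ _ → s≤s z≤n))

sumNZ-suc : ∀ q (f : Fin (suc q) → ℕ) → sumNZ (suc q) f ≡ ∑[ j < q ] f (suc j)
sumNZ-suc q f = trans (cong (List.sum ∘ map f) (nonzeroIdx-suc q)) (sum-map-tabulate f suc)

countNZ-suc : ∀ q (b : Fin (suc q) → Bool) → countNZ (suc q) b ≡ ∑[ j < q ] 𝟙 (b (suc j))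
countNZ-suc q b = trans (length-filter b (nonzeroIdx (suc q))) (sumNZ-suc q (𝟙 ∘ b))

countNZ-sumNZ-expand : ∀ q n a (L S : Fin (suc q) → Bool) (I : Fin (suc q) → ℕ) →
  (countNZ (suc q) L + 1) * n + countNZ (suc q) S * a + sumNZ (suc q) I
  ≡ n + ∑[ j < q ] (𝟙 (L (suc j)) * n + 𝟙 (S (suc j)) * a + I (suc j))
countNZ-sumNZ-expand q n a L S I = begin
  (countNZ (suc q) L + 1) * n + countNZ (suc q) S * a + sumNZ (suc q) I
    ≡⟨ cong₂ (λ l s → (l + 1) * n + s * a + sumNZ (suc q) I) (countNZ-suc q L) (countNZ-suc q S) ⟩
  (∑L + 1) * n + ∑S * a + sumNZ (suc q) I
    ≡⟨ cong ((∑L + 1) * n + ∑S * a +_) (sumNZ-suc q I) ⟩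
  (∑L + 1) * n + ∑S * a + ∑I
    ≡⟨ solve 5 (λ l n s a i → (l :+ con 1) :* n :+ s :* a :+ i := n :+ (l :* n :+ s :* a :+ i)) refl ∑L n ∑S a ∑I ⟩
  n + (∑L * n + ∑S * a + ∑I)
    ≡⟨ cong (λ t → n + (t + ∑I)) (cong₂ _+_ (*-distribʳ-sum n (𝟙 ∘ L ∘ suc)) (*-distribʳ-sum a (𝟙 ∘ S ∘ suc))) ⟩
  n + (∑[ j < q ] (𝟙 (L (suc j)) * n) + ∑[ j < q ] (𝟙 (S (suc j)) * a) + ∑I)
    ≡⟨ cong (λ t → n + (t + ∑I)) (∑-distrib-+ (λ j → 𝟙 (L (suc j)) * n) (λ j → 𝟙 (S (suc j)) * a)) ⟨
  n + (∑[ j < q ] (𝟙 (L (suc j)) * n + 𝟙 (S (suc j)) * a) + ∑I)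
    ≡⟨ cong (n +_) (∑-distrib-+ (λ j → 𝟙 (L (suc j)) * n + 𝟙 (S (suc j)) * a) (I ∘ suc)) ⟨
  n + ∑[ j < q ] (𝟙 (L (suc j)) * n + 𝟙 (S (suc j)) * a + I (suc j))
    ∎
  where
  open ≡-Reasoning
  open +-*-Solver
  ∑L = ∑[ j < q ] 𝟙 (L (suc j))
  ∑S = ∑[ j < q ] 𝟙 (S (suc j))
  ∑I = ∑[ j < q ] I (suc j)

module Cosets {p : ℕ} .{{_ : NonZero p}} (A : Subset p) (idx : G p → Fin p)
              (idx-hom : ∀ x y → idx (x ⊕ y) ≡ idx x +ₚ idx y) where
  open ℤₚ
  open AbelianGroup abelianGroup using (identityˡ)

  Hᵢ : Fin p → Subset p
  Hᵢ = coset idx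

  Aᵢ : Fin p → Subset p
  Aᵢ i = A ∩ Hᵢ i

  Bᵢ : Fin p → Subset p
  Bᵢ i = restrictedSumset A ∩ Hᵢ i

  a₀ : ℕ
  a₀ = card (Aᵢ 0ₚ)

  large : Fin p → Bool
  large i = p ≤ᵇ a₀ + card (Aᵢ i) ∸ 1

  small : Fin p → Bool
  small i = nonempty (Aᵢ i) ∧ (a₀ + card (Aᵢ i) ∸ 1 <ᵇ p)

  emptyTerm : Fin p → ℕ
  emptyTerm i = if not (nonempty (Aᵢ i)) ∧ nonempty (Bᵢ i) then card (Bᵢ i) else 0

  Hᵢ-index : ∀ {i x} → T (Hᵢ i x) → idx x ≡ i
  Hᵢ-index {i} {x} = toWitness {a? = idx x ≟ i}

  Hᵢ-intro : ∀ {i x} → idx x ≡ i → T (Hᵢ i x)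
  Hᵢ-intro {i} {x} = fromWitness {a? = idx x ≟ i}

  Aᵢ-elim : ∀ {i x} → T (Aᵢ i x) → T (A x) × idx x ≡ i
  Aᵢ-elim = map₂ Hᵢ-index ∘ Equivalence.to T-∧

  Aᵢ⊆Hᵢ : ∀ {i} → Aᵢ i ⊆ Hᵢ i
  Aᵢ⊆Hᵢ = Hᵢ-intro ∘ proj₂ ∘ Aᵢ-elim

  Bᵢ-intro : ∀ {i x} → T (restrictedSumset A x) → idx x ≡ i → T (Bᵢ i x)
  Bᵢ-intro Rx idx≡i = Equivalence.from T-∧ (Rx , Hᵢ-intro idx≡i)

  cosets-disjoint : ∀ {i j a b} → i ≢ j → idx a ≡ i → idx b ≡ j → a ≢ b
  cosets-disjoint i≢j a∈Hᵢ b∈Hⱼ refl = i≢j (trans (sym a∈Hᵢ) b∈Hⱼ)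

  card-H₀≡card : (H : Subset p) → (∀ x → (idx x ≡ 0ₚ → H x ≡ true) × (H x ≡ true → idx x ≡ 0ₚ)) →
                 card (Hᵢ 0ₚ) ≡ card H
  card-H₀≡card H H↔H₀ = card-cong (λ x → ⇔→≡ (mk⇔
    (λ H₀x → proj₁ (H↔H₀ x) (Hᵢ-index (Equivalence.from T-≡ H₀x)))
    (λ Hx → Equivalence.to T-≡ (Hᵢ-intro (proj₂ (H↔H₀ x) Hx)))))

  idx-⊕-H₀ : ∀ {y c i} → idx y ≡ 0ₚ → idx c ≡ i → idx (y ⊕ c) ≡ i
  idx-⊕-H₀ {y} {c} {i} y∈H₀ c∈Hᵢ = begin
    idx (y ⊕ c)       ≡⟨ idx-hom y c ⟩
    idx y +ₚ idx c    ≡⟨ cong₂ _+ₚ_ y∈H₀ c∈Hᵢ ⟩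
    0ₚ +ₚ i           ≡⟨ identityˡ i ⟩
    i                 ∎
    where open ≡-Reasoning

  idx-−-H₀ : ∀ {z a i} → idx z ≡ i → idx (z − a) ≡ i → idx a ≡ 0ₚ
  idx-−-H₀ {z} {a} {i} z∈Hᵢ z−a∈Hᵢ = identityʳ-unique i (idx a) (begin
    i +ₚ idx a              ≡⟨ cong (_+ₚ idx a) z−a∈Hᵢ ⟨
    idx (z − a) +ₚ idx a    ≡⟨ idx-hom (z − a) a ⟨
    idx ((z − a) ⊕ a)       ≡⟨ cong idx (−-⊕-cancel z a) ⟩
    idx z                   ≡⟨ z∈Hᵢ ⟩
    i                       ∎)
    where open ≡-Reasoning

  reflected-Aᵢ⊆H₀ : ∀ {z i} → idx z ≡ i → (λ a → Aᵢ i (z − a)) ⊆ Hᵢ 0ₚ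
  reflected-Aᵢ⊆H₀ z∈Hᵢ z−a∈Aᵢ = Hᵢ-intro (idx-−-H₀ z∈Hᵢ (proj₂ (Aᵢ-elim z−a∈Aᵢ)))

  card-H₀≤card-Hᵢ : ∀ {i c} → idx c ≡ i → card (Hᵢ 0ₚ) ≤ card (Hᵢ i)
  card-H₀≤card-Hᵢ {c = c} c∈Hᵢ = card-≤-translate c (λ y∈H₀ → Hᵢ-intro (idx-⊕-H₀ (Hᵢ-index y∈H₀) c∈Hᵢ))

  a₀≤card-Bᵢ : ∀ {i c} → i ≢ 0ₚ → T (Aᵢ i c) → a₀ ≤ card (Bᵢ i)
  a₀≤card-Bᵢ {i} {c} i≢0 c∈Aᵢ = card-≤-translate c y+c∈Bᵢ
    where
    y+c∈Bᵢ : Aᵢ 0ₚ ⊆ (λ y → Bᵢ i (y ⊕ c))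
    y+c∈Bᵢ {y} y∈A₀ with Ay , y∈H₀ ← Aᵢ-elim y∈A₀ | Ac , c∈Hᵢ ← Aᵢ-elim c∈Aᵢ =
      Bᵢ-intro (restrictedSumset-intro A Ay (subst (T ∘ A) (sym (⊕-−-cancelˡ y c)) Ac)
                  (cosets-disjoint (≢-sym i≢0) y∈H₀ (trans (cong idx (⊕-−-cancelˡ y c)) c∈Hᵢ)))
               (idx-⊕-H₀ y∈H₀ c∈Hᵢ)

  Hᵢ⊆Bᵢ : ∀ {i} → i ≢ 0ₚ → card (Hᵢ 0ₚ) < a₀ + card (Aᵢ i) → Hᵢ i ⊆ Bᵢ i
  Hᵢ⊆Bᵢ {i} i≢0 H₀<a₀+aᵢ {z} z∈Hᵢ =
    -- Nothing is excluded: a ∈ H₀ and z − a ∈ Hᵢ are automatically distinct.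
    z∈Bᵢ (pigeonhole (λ _ → false) Aᵢ⊆Hᵢ (reflected-Aᵢ⊆H₀ (Hᵢ-index z∈Hᵢ)) bound)
    where
    bound : card (Hᵢ 0ₚ) + card {p} (λ _ → false) < a₀ + card (λ a → Aᵢ i (z − a))
    bound = subst₂ (λ e r → card (Hᵢ 0ₚ) + e < a₀ + r) (sym (card-∅ {p})) (sym (card-reflect (Aᵢ i) z))
                   (subst (_< a₀ + card (Aᵢ i)) (sym (+-identityʳ _)) H₀<a₀+aᵢ)
    z∈Bᵢ : ∃[ a ] T (Aᵢ 0ₚ a) × T (Aᵢ i (z − a)) × T true → T (Bᵢ i z)
    z∈Bᵢ (a , a∈A₀ , z−a∈Aᵢ , _) with Aa , a∈H₀ ← Aᵢ-elim a∈A₀ | Az−a , z−a∈Hᵢ ← Aᵢ-elim z−a∈Aᵢ =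
      Bᵢ-intro (restrictedSumset-intro A Aa Az−a (cosets-disjoint (≢-sym i≢0) a∈H₀ z−a∈Hᵢ))
               (Hᵢ-index z∈Hᵢ)

  H₀⊆B₀ : Prime p → 2 < p → card (Hᵢ 0ₚ) + 1 < a₀ + a₀ → Hᵢ 0ₚ ⊆ Bᵢ 0ₚ
  H₀⊆B₀ pr 2<p H₀+1<2a₀ {x} x∈H₀ =
    x∈B₀ (pigeonhole halves Aᵢ⊆Hᵢ (reflected-Aᵢ⊆H₀ (Hᵢ-index x∈H₀)) bound)
    where
    halves : Subset p
    halves a = ⌊ a ≟G (x − a) ⌋
    double : ∀ {a} → T (halves a) → a ⊕ a ≡ x
    double {a} a≡x−a = trans (cong (_⊕ a) (toWitness a≡x−a)) (−-⊕-cancel x a)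
    bound : card (Hᵢ 0ₚ) + card halves < a₀ + card (λ a → Aᵢ 0ₚ (x − a))
    bound = begin-strict
      card (Hᵢ 0ₚ) + card halves  ≤⟨ +-monoʳ-≤ (card (Hᵢ 0ₚ)) (card-subsingleton halves
                                       (λ ha hb → ⊕-double-injective pr 2<p _ _ (trans (double ha) (sym (double hb))))) ⟩
      card (Hᵢ 0ₚ) + 1            <⟨ H₀+1<2a₀ ⟩
      a₀ + a₀                     ≡⟨ cong (a₀ +_) (card-reflect (Aᵢ 0ₚ) x) ⟨
      a₀ + card (λ a → Aᵢ 0ₚ (x − a)) ∎
      where open ≤-Reasoning
    x∈B₀ : ∃[ a ] T (Aᵢ 0ₚ a) × T (Aᵢ 0ₚ (x − a)) × T (not (halves a)) → T (Bᵢ 0ₚ x)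
    x∈B₀ (a , a∈A₀ , x−a∈A₀ , a≢x−a) =
      Bᵢ-intro (restrictedSumset-intro A (proj₁ (Aᵢ-elim a∈A₀)) (proj₁ (Aᵢ-elim x−a∈A₀)) (toWitnessFalse a≢x−a))
               (Hᵢ-index x∈H₀)

  module _ (card-H₀ : card (Hᵢ 0ₚ) ≡ p) where

    a₀≤p : a₀ ≤ p
    a₀≤p = subst (a₀ ≤_) card-H₀ (card-mono {X = Aᵢ 0ₚ} {Y = Hᵢ 0ₚ} Aᵢ⊆Hᵢ)

    large⇒< : ∀ {i} → large i ≡ true → p < a₀ + card (Aᵢ i)
    large⇒< L = ≤∸1⇒< _ (≤ᵇ⇒≤ p _ (Equivalence.from T-≡ L))

    large⇒nonempty : ∀ {i} → p < a₀ + card (Aᵢ i) → T (nonempty (Aᵢ i))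
    large⇒nonempty {i} p<a₀+aᵢ = nonempty-intro (Aᵢ i) (proj₂ (card-witness (Aᵢ i) 0<aᵢ))
      where
      0<aᵢ : 0 < card (Aᵢ i)
      0<aᵢ = +-cancelˡ-< a₀ 0 (card (Aᵢ i)) (≤-<-trans (≤-reflexive (+-identityʳ a₀)) (≤-<-trans a₀≤p p<a₀+aᵢ))

    large⇒p≤card-Bᵢ : ∀ {i} → i ≢ 0ₚ → p < a₀ + card (Aᵢ i) → p ≤ card (Bᵢ i)
    large⇒p≤card-Bᵢ {i} i≢0 p<a₀+aᵢ with c , c∈Aᵢ ← nonempty-witness (Aᵢ i) (large⇒nonempty p<a₀+aᵢ) = begin
      p                ≡⟨ card-H₀ ⟨
      card (Hᵢ 0ₚ)     ≤⟨ card-H₀≤card-Hᵢ (proj₂ (Aᵢ-elim c∈Aᵢ)) ⟩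
      card (Hᵢ i)      ≤⟨ card-mono {X = Hᵢ i} {Y = Bᵢ i} (Hᵢ⊆Bᵢ i≢0 H₀<a₀+aᵢ) ⟩
      card (Bᵢ i)      ∎
      where
      open ≤-Reasoning
      H₀<a₀+aᵢ : card (Hᵢ 0ₚ) < a₀ + card (Aᵢ i)
      H₀<a₀+aᵢ = subst (_< a₀ + card (Aᵢ i)) (sym card-H₀) p<a₀+aᵢ

    p≤card-B₀ : Prime p → 5 ≤ p → p + 3 ≤ 2 * a₀ → p ≤ card (Bᵢ 0ₚ)
    p≤card-B₀ pr 5≤p p+3≤2a₀ =
      subst (_≤ card (Bᵢ 0ₚ)) card-H₀ (card-mono {X = Hᵢ 0ₚ} {Y = Bᵢ 0ₚ} (H₀⊆B₀ pr 2<p H₀+1<2a₀))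
      where
      2<p : 2 < p
      2<p = ≤-trans (s≤s (s≤s (s≤s z≤n))) 5≤p
      H₀+1<2a₀ : card (Hᵢ 0ₚ) + 1 < a₀ + a₀
      H₀+1<2a₀ = begin-strict
        card (Hᵢ 0ₚ) + 1   ≡⟨ cong (_+ 1) card-H₀ ⟩
        p + 1              <⟨ +-monoʳ-< p (s≤s (s≤s z≤n)) ⟩
        p + 3              ≤⟨ p+3≤2a₀ ⟩
        2 * a₀             ≡⟨ cong (a₀ +_) (+-identityʳ a₀) ⟩
        a₀ + a₀            ∎
        where open ≤-Reasoning

    coset-bound : ∀ i → i ≢ 0ₚ → 𝟙 (large i) * p + 𝟙 (small i) * a₀ + emptyTerm i ≤ card (Bᵢ i)
    coset-bound i i≢0 with nonempty (Aᵢ i) in Aᵢ≠∅? | large i in large?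
    ... | false | true  = ⊥-elim (subst T Aᵢ≠∅? (large⇒nonempty (large⇒< large?)))
    ... | false | false = if-then-else-0-≤ (nonempty (Bᵢ i)) (card (Bᵢ i))
    ... | true  | true with a₀ + card (Aᵢ i) ∸ 1 <ᵇ p in small?
    ...   | true  = contradiction (≤ᵇ⇒≤ p _ (Equivalence.from T-≡ large?)) (<⇒≱ (<ᵇ⇒< _ p (Equivalence.from T-≡ small?)))
    ...   | false = subst (_≤ card (Bᵢ i)) (sym (trans (+-identityʳ _) (trans (+-identityʳ _) (+-identityʳ p))))
                      (large⇒p≤card-Bᵢ i≢0 (large⇒< large?))
    coset-bound i i≢0 | true | false with c , c∈Aᵢ ← nonempty-witness (Aᵢ i) (Equivalence.from T-≡ Aᵢ≠∅?) =
      subst (_≤ card (Bᵢ i)) (sym (+-identityʳ _)) (≤-trans (𝟙*≤ (a₀ + card (Aᵢ i) ∸ 1 <ᵇ p) a₀) (a₀≤card-Bᵢ i≢0 c∈Aᵢ))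

lemma3p2 : (p : ℕ) .{{_ : NonZero p}} → Prime p → 5 ≤ p →
    (A : Subset p) → card A ≡ 2 * p + 1 →
    (H : Subset p) → H 𝟘 ≡ true →
    (∀ x y → H x ≡ true → H y ≡ true → H (x ⊕ y) ≡ true) →
    (∀ x → H x ≡ true → H (⊖ x) ≡ true) →
    card H ≡ p →
    (idx : G p → Fin p) →
    (∀ x y → idx (x ⊕ y) ≡ idx x +ₚ idx y) →
    (∀ x → (idx x ≡ 0ₚ → H x ≡ true) × (H x ≡ true → idx x ≡ 0ₚ)) →
    let Aᵢ : Fin p → Subset p
        Aᵢ i = A ∩ coset idx i
        Bᵢ : Fin p → Subset p
        Bᵢ i = restrictedSumset A ∩ coset idx i
        a₀ : ℕ
        a₀ = card (Aᵢ 0ₚ)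
        ℓ : ℕ
        ℓ = countNZ p (λ i → p ≤ᵇ a₀ + card (Aᵢ i) ∸ 1)
        s : ℕ
        s = countNZ p (λ i → nonempty (Aᵢ i) ∧ (a₀ + card (Aᵢ i) ∸ 1 <ᵇ p))
    in (∀ i → card (Aᵢ i) ≤ a₀) →
       p + 3 ≤ 2 * a₀ →
       (ℓ + 1) * p + s * a₀
         + sumNZ p (λ i → if not (nonempty (Aᵢ i)) ∧ nonempty (Bᵢ i) then card (Bᵢ i) else 0)
         ≤ card (restrictedSumset A)
lemma3p2 zero _ ()
lemma3p2 (suc q) p-prime 5≤p A _ H _ _ _ card-H idx idx-hom H↔idx₀ _ p+3≤2a₀ = begin
  (countNZ p large + 1) * p + countNZ p small * a₀ + sumNZ p emptyTerm
    ≡⟨ countNZ-sumNZ-expand q p a₀ large small emptyTerm ⟩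
  p + ∑[ j < q ] (𝟙 (large (suc j)) * p + 𝟙 (small (suc j)) * a₀ + emptyTerm (suc j))
    ≤⟨ +-mono-≤ (p≤card-B₀ card-H₀ p-prime 5≤p p+3≤2a₀) (sum-mono (λ j → coset-bound card-H₀ (suc j) λ ())) ⟩
  card (Bᵢ zero) + ∑[ j < q ] card (Bᵢ (suc j))
    ≡⟨ card-partition (restrictedSumset A) idx ⟨
  card (restrictedSumset A)
    ∎
  where
  p = suc q
  open Cosets A idx idx-hom
  open ≤-Reasoning
  card-H₀ : card (Hᵢ 0ₚ) ≡ p
  card-H₀ = trans (card-H₀≡card H H↔idx₀) card-H
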